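{- For every rule of $LS_{BBI}$ other than cut and every instance of it (satisfying its side conditions): if $\Pi$ is a cut-free $LS_{BBI}$ derivation of the conclusion of the instance, then each premise of the instance has a cut-free $LS_{BBI}$ derivation of height at most $ht(\Pi)$.
   Context: BBI formulae: $A ::= p \mid \top \mid \bot \mid \neg A \mid A\lor A \mid A\land A \mid A\to A \mid \top^* \mid A * A \mid A \mathrel{ -\!*} A$, $p$ atomic; $\neg A$ abbreviates $A\to\bot$ and $A\lor B$ abbreviates $\neg(\neg A\land\neg B)$. Labels are label variables (from an infinite set $LVar$) or the constant $\epsilon$. A labelled formula is $w:A$; a relational atom is $(x,y\triangleright z)$ for labels $x,y,z$. A sequent $\Gamma\vdash\Delta$ has $\Gamma$ a finite multiset of labelled formulae and relational atoms and $\Delta$ a finite multiset of labelled formulae; ";" is multiset union. $\Gamma[y/x]$ replaces every occurrence of label $x$ by $y$. The height $ht(\Pi)$ of a derivation is the length of a longest branch in its derivation tree. Rules of $LS_{BBI}$ ("from premises infer conclusion"; $P$ atomic): id: infer $\Gamma;w:P\vdash w:P;\Delta$. $\bot L$: infer $\Gamma;w:\bot\vdash\Delta$. $\top R$: infer $\Gamma\vdash w:\top;\Delta$. $\top^*R$: infer $\Gamma\vdash\epsilon:\top^*;\Delta$. cut: from $\Gamma\vdash x:A;\Delta$ and $\Gamma';x:A\vdash\Delta'$ infer $\Gamma;\Gamma'\vdash\Delta;\Delta'$. $\top^*L$: from $\Gamma[\epsilon/w]\vdash\Delta[\epsilon/w]$ infer $\Gamma;w:\top^*\vdash\Delta$ ($w\neq\epsilon$).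 $\land L$: from $\Gamma;w:A;w:B\vdash\Delta$ infer $\Gamma;w:A\land B\vdash\Delta$. $\land R$: from $\Gamma\vdash w:A;\Delta$ and $\Gamma\vdash w:B;\Delta$ infer $\Gamma\vdash w:A\land B;\Delta$. $\to L$: from $\Gamma\vdash w:A;\Delta$ and $\Gamma;w:B\vdash\Delta$ infer $\Gamma;w:A\to B\vdash\Delta$. $\to R$: from $\Gamma;w:A\vdash w:B;\Delta$ infer $\Gamma\vdash w:A\to B;\Delta$. $*L$: from $(x,y\triangleright z);\Gamma;x:A;y:B\vdash\Delta$ infer $\Gamma;z:A*B\vdash\Delta$ ($x,y$ not in the conclusion). $\mathrel{ -\!*}R$: from $(x,y\triangleright z);\Gamma;x:A\vdash z:B;\Delta$ infer $\Gamma\vdash y:A\mathrel{ -\!*}B;\Delta$ ($x,z$ not in the conclusion). $*R$: from $(x,y\triangleright z);\Gamma\vdash x:A;z:A*B;\Delta$ and $(x,y\triangleright z);\Gamma\vdash y:B;z:A*B;\Delta$ infer $(x,y\triangleright z);\Gamma\vdash z:A*B;\Delta$. $\mathrel{ -\!*}L$: from $(x,y\triangleright z);\Gamma;y:A\mathrel{ -\!*}B\vdash x:A;\Delta$ and $(x,y\triangleright z);\Gamma;y:A\mathrel{ -\!*}B;z:B\vdash\Delta$ infer $(x,y\triangleright z);\Gamma;y:A\mathrel{ -\!*}B\vdash\Delta$. E: from $(y,x\triangleright z);(x,y\triangleright z);\Gamma\vdash\Delta$ infer $(x,y\triangleright z);\Gamma\vdash\Delta$. U: from $(x,\epsilon\triangleright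 x);\Gamma\vdash\Delta$ infer $\Gamma\vdash\Delta$. A: from $(u,w\triangleright z);(y,v\triangleright w);(x,y\triangleright z);(u,v\triangleright x);\Gamma\vdash\Delta$ infer $(x,y\triangleright z);(u,v\triangleright x);\Gamma\vdash\Delta$ ($w$ not in the conclusion). $A_C$: from $(x,w\triangleright x);(y,y\triangleright w);(x,y\triangleright x);\Gamma\vdash\Delta$ infer $(x,y\triangleright x);\Gamma\vdash\Delta$ ($w$ not in the conclusion). $Eq_1$: from $(\epsilon,w'\triangleright w');\Gamma[w'/w]\vdash\Delta[w'/w]$ infer $(\epsilon,w\triangleright w');\Gamma\vdash\Delta$ ($w\neq\epsilon$). $Eq_2$: from $(\epsilon,w'\triangleright w');\Gamma[w'/w]\vdash\Delta[w'/w]$ infer $(\epsilon,w'\triangleright w);\Gamma\vdash\Delta$ ($w\neq\epsilon$). -}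

module Defs where

open import Data.Nat using (ℕ; zero; suc; _⊔_)
open import Data.Nat.Properties using () renaming (_≟_ to _≟ℕ_)
open import Data.List using (List; []; _∷_; _++_; map; concatMap)
open import Data.List.Membership.Propositional using (_∉_)
open import Data.List.Relation.Binary.Permutation.Propositional using (_↭_)
open import Data.Product using (_×_; _,_)
open import Relation.Binary.PropositionalEquality using (_≡_; _≢_; refl; cong)
open import Data.Empty using (⊥)
open import Data.Unit using (⊤)
open import Relation.Nullary using (Dec; yes; no; ¬_)

infixr 6 _∧'_
infixr 5 _⇒_
infixr 7 _✶_
infixr 5 _−✶_

data Form : Set where
  atom : ℕ → Form
  ⊤'   : Form
  ⊥'   : Form
  _∧'_ : Form → Form → Form
  _⇒_  : Form → Form → Form
  ⊤*   : Form
  _✶_  : Form → Form → Form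
  _−✶_ : Form → Form → Form

¬'_ : Form → Form
¬' A = A ⇒ ⊥'

_∨'_ : Form → Form → Form
A ∨' B = ¬' (¬' A ∧' ¬' B)

data Label : Set where
  ε   : Label
  var : ℕ → Label

IsVar : Label → Set
IsVar ε       = ⊥
IsVar (var _) = ⊤

_≟L_ : (x y : Label) → Dec (x ≡ y)
ε     ≟L ε     = yes refl
ε     ≟L var _ = no (λ ())
var _ ≟L ε     = no (λ ())
var m ≟L var n with m ≟ℕ n
... | yes refl = yes refl
... | no m≢n   = no (λ { refl → m≢n refl })

infix 4 _∶_
data LF : Set where
  _∶_ : Label → Form → LF

data Item : Set where
  lf  : LF → Item
  rel : Label → Label → Label → Item   -- rel x y z  is  (x , y ▷ z)

-- sequents Γ ⊢ Δ; the multisets are lists, taken up to permutation (_≈S_)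
infix 3 _⊢_
record Seq : Set where
  constructor _⊢_
  field
    ant : List Item
    succ : List LF
open Seq public

_≈S_ : Seq → Seq → Set
(Γ ⊢ Δ) ≈S (Γ' ⊢ Δ') = (Γ ↭ Γ') × (Δ ↭ Δ')

substL : Label → Label → Label → Label
substL y x l with l ≟L x
... | yes _ = y
... | no  _ = l

substLF : Label → Label → LF → LF
substLF y x (w ∶ A) = substL y x w ∶ A

substItem : Label → Label → Item → Item
substItem y x (lf a)      = lf (substLF y x a)
substItem y x (rel a b c) = rel (substL y x a) (substL y x b) (substL y x c)

substCtx : Label → Label → List Item → List Item
substCtx y x = map (substItem y x)

substSuc : Label → Label → List LF → List LF
substSuc y x = map (substLF y x)

labelsLF : LF → List Label
labelsLF (w ∶ _) = w ∷ []

labelsItem : Item → List Label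
labelsItem (lf a)      = labelsLF a
labelsItem (rel a b c) = a ∷ b ∷ c ∷ []

labelsSeq : Seq → List Label
labelsSeq (Γ ⊢ Δ) = concatMap labelsItem Γ ++ concatMap labelsLF Δ

Fresh : Label → Seq → Set
Fresh x s = IsVar x × (x ∉ labelsSeq s)

data Inst0 : Seq → Set where
  id  : ∀ {Γ Δ w p} → Inst0 (lf (w ∶ atom p) ∷ Γ ⊢ (w ∶ atom p) ∷ Δ)
  ⊥L  : ∀ {Γ Δ w} → Inst0 (lf (w ∶ ⊥') ∷ Γ ⊢ Δ)
  ⊤R  : ∀ {Γ Δ w} → Inst0 (Γ ⊢ (w ∶ ⊤') ∷ Δ)
  ⊤*R : ∀ {Γ Δ} → Inst0 (Γ ⊢ (ε ∶ ⊤*) ∷ Δ)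

-- one-premise rules:  Inst1 premise conclusion
data Inst1 : Seq → Seq → Set where
  ⊤*L : ∀ {Γ Δ w} → w ≢ ε →
        Inst1 (substCtx ε w Γ ⊢ substSuc ε w Δ) (lf (w ∶ ⊤*) ∷ Γ ⊢ Δ)
  ∧L  : ∀ {Γ Δ w A B} →
        Inst1 (lf (w ∶ A) ∷ lf (w ∶ B) ∷ Γ ⊢ Δ) (lf (w ∶ A ∧' B) ∷ Γ ⊢ Δ)
  ⇒R  : ∀ {Γ Δ w A B} →
        Inst1 (lf (w ∶ A) ∷ Γ ⊢ (w ∶ B) ∷ Δ) (Γ ⊢ (w ∶ A ⇒ B) ∷ Δ)
  ✶L  : ∀ {Γ Δ x y z A B} →
        Fresh x (lf (z ∶ A ✶ B) ∷ Γ ⊢ Δ) → Fresh y (lf (z ∶ A ✶ B) ∷ Γ ⊢ Δ) → x ≢ y →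
        Inst1 (rel x y z ∷ lf (x ∶ A) ∷ lf (y ∶ B) ∷ Γ ⊢ Δ) (lf (z ∶ A ✶ B) ∷ Γ ⊢ Δ)
  −✶R : ∀ {Γ Δ x y z A B} →
        Fresh x (Γ ⊢ (y ∶ A −✶ B) ∷ Δ) → Fresh z (Γ ⊢ (y ∶ A −✶ B) ∷ Δ) → x ≢ z →
        Inst1 (rel x y z ∷ lf (x ∶ A) ∷ Γ ⊢ (z ∶ B) ∷ Δ) (Γ ⊢ (y ∶ A −✶ B) ∷ Δ)
  E   : ∀ {Γ Δ x y z} →
        Inst1 (rel y x z ∷ rel x y z ∷ Γ ⊢ Δ) (rel x y z ∷ Γ ⊢ Δ)
  U   : ∀ {Γ Δ x} →
        Inst1 (rel x ε x ∷ Γ ⊢ Δ) (Γ ⊢ Δ)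
  A   : ∀ {Γ Δ x y z u v w} →
        Fresh w (rel x y z ∷ rel u v x ∷ Γ ⊢ Δ) →
        Inst1 (rel u w z ∷ rel y v w ∷ rel x y z ∷ rel u v x ∷ Γ ⊢ Δ)
              (rel x y z ∷ rel u v x ∷ Γ ⊢ Δ)
  AC  : ∀ {Γ Δ x y w} →
        Fresh w (rel x y x ∷ Γ ⊢ Δ) →
        Inst1 (rel x w x ∷ rel y y w ∷ rel x y x ∷ Γ ⊢ Δ) (rel x y x ∷ Γ ⊢ Δ)
  Eq₁ : ∀ {Γ Δ w w'} → w ≢ ε →
        Inst1 (rel ε w' w' ∷ substCtx w' w Γ ⊢ substSuc w' w Δ) (rel ε w w' ∷ Γ ⊢ Δ)
  Eq₂ : ∀ {Γ Δ w w'} → w ≢ ε →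
        Inst1 (rel ε w' w' ∷ substCtx w' w Γ ⊢ substSuc w' w Δ) (rel ε w' w ∷ Γ ⊢ Δ)

-- two-premise rules:  Inst2 premise₁ premise₂ conclusion
data Inst2 : Seq → Seq → Seq → Set where
  ∧R  : ∀ {Γ Δ w A B} →
        Inst2 (Γ ⊢ (w ∶ A) ∷ Δ) (Γ ⊢ (w ∶ B) ∷ Δ) (Γ ⊢ (w ∶ A ∧' B) ∷ Δ)
  ⇒L  : ∀ {Γ Δ w A B} →
        Inst2 (Γ ⊢ (w ∶ A) ∷ Δ) (lf (w ∶ B) ∷ Γ ⊢ Δ) (lf (w ∶ A ⇒ B) ∷ Γ ⊢ Δ)
  ✶R  : ∀ {Γ Δ x y z A B} →
        Inst2 (rel x y z ∷ Γ ⊢ (x ∶ A) ∷ (z ∶ A ✶ B) ∷ Δ)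
              (rel x y z ∷ Γ ⊢ (y ∶ B) ∷ (z ∶ A ✶ B) ∷ Δ)
              (rel x y z ∷ Γ ⊢ (z ∶ A ✶ B) ∷ Δ)
  −✶L : ∀ {Γ Δ x y z A B} →
        Inst2 (rel x y z ∷ lf (y ∶ A −✶ B) ∷ Γ ⊢ (x ∶ A) ∷ Δ)
              (rel x y z ∷ lf (y ∶ A −✶ B) ∷ lf (z ∶ B) ∷ Γ ⊢ Δ)
              (rel x y z ∷ lf (y ∶ A −✶ B) ∷ Γ ⊢ Δ)

-- Cut-free LS_BBI derivations.  Each inference may conclude any sequent that
-- is equal as a pair of multisets (i.e. up to permutation) to the rule
-- instance's conclusion.

data Deriv : Seq → Set where
  ax  : ∀ {c c'} → Inst0 c → c ≈S c' → Deriv c'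
  un  : ∀ {p c c'} → Inst1 p c → c ≈S c' → Deriv p → Deriv c'
  bin : ∀ {p q c c'} → Inst2 p q c → c ≈S c' → Deriv p → Deriv q → Deriv c'

ht : ∀ {s} → Deriv s → ℕ
ht (ax _ _)      = 1
ht (un _ _ d)    = suc (ht d)
ht (bin _ _ d e) = suc (ht d ⊔ ht e)

-- The premises of a rule are obtained from its conclusion by three operations: weakening
-- (structural rules), renaming labels (⊤*L, Eq₁, Eq₂) and inversion (logical rules).  All
-- three are proved height-preserving at once, by induction on the derivation: if a sequent has
-- a derivation of height n then so does each of its variants, i.e. the image under a label map
-- f fixing ε, weakened, with one occurrence of an invertible formula replaced by the renamed
-- components of its premise.  The renaming is what makes the side conditions go through: the
-- eigenvariables of ✶L, −✶R, A and A_C are redirected to labels fresh for the target, and the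
-- substitutions of ⊤*L and Eq₁/Eq₂ are composed with f.  Since f may send a label to ε, the
-- renamed instances of the latter rules can degenerate and are treated separately.

module Submission where

open import Defs
open import Data.Nat using (ℕ; suc; _⊔_; _≤_; _<_; s≤s)
open import Data.Nat.Properties using (≤-refl; ≤-trans; m≤m⊔n; m≤n⊔m; ⊔-mono-≤; m≤n⇒m≤1+n; n≤1+n; <-irrefl; 1+n≢n)
open import Data.List using (List; []; _∷_; _++_; map; concatMap)
open import Data.List.Properties using (map-++; map-id; map-∘; map-cong; ++-assoc)
open import Data.List.Membership.Propositional using (_∈_; _∉_)
open import Data.List.Membership.Propositional.Properties using (∈-++⁺ˡ; ∈-++⁺ʳ; ∈-++⁻; ∈-∃++; ∈-concatMap⁺)
open import Data.List.Relation.Unary.Any using (here; there) renaming (map to any-map)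
open import Data.List.Relation.Binary.Subset.Propositional using (_⊆_)
open import Data.List.Relation.Binary.Subset.Propositional.Properties using (concatMap⁺; xs⊆ys++xs) renaming (++⁺ to ⊆-++⁺)
open import Data.List.Relation.Binary.Permutation.Propositional
  using (_↭_; ↭-refl; ↭-sym; ↭-trans; ↭-reflexive; prep; swap)
open import Data.List.Relation.Binary.Permutation.Propositional.Properties
  using (++⁺ˡ; ++⁺; shift; shifts; drop-∷; map⁺; ∈-resp-↭)
open import Data.Product using (Σ; _×_; _,_; proj₁; proj₂)
open import Data.Sum using (_⊎_; inj₁; inj₂)
open import Data.Empty using (⊥-elim)
open import Data.Unit using (tt)
open import Function using (_∘_)
open import Relation.Nullary using (Dec; yes; no; ¬_)
open import Relation.Binary.PropositionalEquality
  using (_≡_; _≢_; _≗_; refl; sym; trans; cong; cong₂; subst)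

Renaming : Set
Renaming = Label → Label

renameLF : Renaming → LF → LF
renameLF f (w ∶ F) = f w ∶ F

renameItem : Renaming → Item → Item
renameItem f (lf a)      = lf (renameLF f a)
renameItem f (rel x y z) = rel (f x) (f y) (f z)

renameAnt : Renaming → List Item → List Item
renameAnt f = map (renameItem f)

renameSuc : Renaming → List LF → List LF
renameSuc f = map (renameLF f)

renameSeq : Renaming → Seq → Seq
renameSeq f (Γ ⊢ Δ) = renameAnt f Γ ⊢ renameSuc f Δ

rel-cong : ∀ {x y z x' y' z'} → x ≡ x' → y ≡ y' → z ≡ z' → rel x y z ≡ rel x' y' z'
rel-cong refl refl refl = refl

renameItem-cong : ∀ {f g} → f ≗ g → renameItem f ≗ renameItem g
renameItem-cong f≗g (lf (w ∶ F)) = cong (λ u → lf (u ∶ F)) (f≗g w)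
renameItem-cong f≗g (rel x y z)  = rel-cong (f≗g x) (f≗g y) (f≗g z)

renameLF-cong : ∀ {f g} → f ≗ g → renameLF f ≗ renameLF g
renameLF-cong f≗g (w ∶ F) = cong (_∶ F) (f≗g w)

renameItem-∘ : ∀ f g → renameItem (f ∘ g) ≗ renameItem f ∘ renameItem g
renameItem-∘ f g (lf (_ ∶ _)) = refl
renameItem-∘ f g (rel _ _ _)  = refl

renameLF-∘ : ∀ f g → renameLF (f ∘ g) ≗ renameLF f ∘ renameLF g
renameLF-∘ f g (_ ∶ _) = refl

renameAnt-∘ : ∀ f g → renameAnt (f ∘ g) ≗ renameAnt f ∘ renameAnt g
renameAnt-∘ f g Γ = trans (map-cong (renameItem-∘ f g) Γ) (map-∘ Γ)

renameSuc-∘ : ∀ f g → renameSuc (f ∘ g) ≗ renameSuc f ∘ renameSuc g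
renameSuc-∘ f g Δ = trans (map-cong (renameLF-∘ f g) Δ) (map-∘ Δ)

renameAnt-id : ∀ Γ → renameAnt (λ l → l) Γ ≡ Γ
renameAnt-id Γ = trans (map-cong (λ { (lf (_ ∶ _)) → refl ; (rel _ _ _) → refl }) Γ) (map-id Γ)

renameSuc-id : ∀ Δ → renameSuc (λ l → l) Δ ≡ Δ
renameSuc-id Δ = trans (map-cong (λ { (_ ∶ _) → refl }) Δ) (map-id Δ)

substL-hit : ∀ y x → substL y x x ≡ y
substL-hit y x with x ≟L x
... | yes _  = refl
... | no x≢x = ⊥-elim (x≢x refl)

substL-target : ∀ y x → substL y x y ≡ y
substL-target y x with y ≟L x
... | yes _ = refl
... | no _  = refl

substL-ε : ∀ {y x} → x ≢ ε → substL y x ε ≡ ε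
substL-ε {y} {x} x≢ε with ε ≟L x
... | yes ε≡x = ⊥-elim (x≢ε (sym ε≡x))
... | no _    = refl

substL-trivial : ∀ x l → substL x x l ≡ l
substL-trivial x l with l ≟L x
... | yes refl = refl
... | no _     = refl

substL-absorbed : ∀ (g : Renaming) {y x} → g y ≡ g x → ∀ l → g (substL y x l) ≡ g l
substL-absorbed g {y} {x} gy≡gx l with l ≟L x
... | yes refl = gy≡gx
... | no _     = refl

substSeq-rename : ∀ y x Γ Δ → (substCtx y x Γ ⊢ substSuc y x Δ) ≡ renameSeq (substL y x) (Γ ⊢ Δ)
substSeq-rename y x Γ Δ = cong₂ _⊢_ (map-cong (λ { (lf (_ ∶ _)) → refl ; (rel _ _ _) → refl }) Γ)
                                    (map-cong (λ { (_ ∶ _) → refl }) Δ)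

renameSeq-trivial : ∀ x Γ Δ → renameSeq (substL x x) (Γ ⊢ Δ) ≡ (Γ ⊢ Δ)
renameSeq-trivial x Γ Δ = cong₂ _⊢_ (trans (map-cong (renameItem-cong (substL-trivial x)) Γ) (renameAnt-id Γ))
                                    (trans (map-cong (renameLF-cong (substL-trivial x)) Δ) (renameSuc-id Δ))

labelsAnt : List Item → List Label
labelsAnt = concatMap labelsItem

labelsSuc : List LF → List Label
labelsSuc = concatMap labelsLF

labelsItem⊆labelsAnt : ∀ {φ Γ} → φ ∈ Γ → labelsItem φ ⊆ labelsAnt Γ
labelsItem⊆labelsAnt φ∈Γ l∈φ = ∈-concatMap⁺ labelsItem (any-map (λ { refl → l∈φ }) φ∈Γ)

labelsLF⊆labelsSuc : ∀ {ψ Δ} → ψ ∈ Δ → labelsLF ψ ⊆ labelsSuc Δ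
labelsLF⊆labelsSuc ψ∈Δ l∈ψ = ∈-concatMap⁺ labelsLF (any-map (λ { refl → l∈ψ }) ψ∈Δ)

AgreeOn : List Label → Renaming → Renaming → Set
AgreeOn L f g = ∀ {l} → l ∈ L → f l ≡ g l

renameAnt-local : ∀ {f g} Γ → AgreeOn (labelsAnt Γ) f g → renameAnt f Γ ≡ renameAnt g Γ
renameAnt-local []               agree = refl
renameAnt-local (lf (w ∶ F) ∷ Γ) agree =
  cong₂ _∷_ (cong (λ u → lf (u ∶ F)) (agree (here refl))) (renameAnt-local Γ (agree ∘ there))
renameAnt-local (rel x y z ∷ Γ)  agree =
  cong₂ _∷_ (rel-cong (agree (here refl)) (agree (there (here refl))) (agree (there (there (here refl)))))
            (renameAnt-local Γ (agree ∘ there ∘ there ∘ there))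

renameSuc-local : ∀ {f g} Δ → AgreeOn (labelsSuc Δ) f g → renameSuc f Δ ≡ renameSuc g Δ
renameSuc-local []            agree = refl
renameSuc-local ((w ∶ F) ∷ Δ) agree = cong₂ _∷_ (cong (_∶ F) (agree (here refl))) (renameSuc-local Δ (agree ∘ there))

infixl 9 _[_↦_]
_[_↦_] : Renaming → Label → Label → Renaming
(f [ x ↦ y ]) l with l ≟L x
... | yes _ = y
... | no _  = f l

update-hit : ∀ f x y → (f [ x ↦ y ]) x ≡ y
update-hit f x y with x ≟L x
... | yes _  = refl
... | no x≢x = ⊥-elim (x≢x refl)

update-miss : ∀ {f x y l} → l ≢ x → (f [ x ↦ y ]) l ≡ f l
update-miss {f} {x} {y} {l} l≢x with l ≟L x
... | yes l≡x = ⊥-elim (l≢x l≡x)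
... | no _    = refl

update-agrees : ∀ {f x y L} → x ∉ L → AgreeOn L (f [ x ↦ y ]) f
update-agrees {f} {x} {y} x∉L {l} l∈L = update-miss {f} {x} {y} {l} λ { refl → x∉L l∈L }

update-ε : ∀ {f x y} → IsVar x → f ε ≡ ε → (f [ x ↦ y ]) ε ≡ ε
update-ε {f} {var k} {y} _ fε = trans (update-miss {f} {var k} {y} {ε} λ ()) fε

update₂-fresh : ∀ {f x y x' y'} s → Fresh x s → Fresh y s → AgreeOn (labelsSeq s) (f [ x ↦ x' ] [ y ↦ y' ]) f
update₂-fresh s (_ , x∉) (_ , y∉) l∈s = trans (update-agrees y∉ l∈s) (update-agrees x∉ l∈s)

update₂-ε : ∀ {f x y x' y'} → IsVar x → IsVar y → f ε ≡ ε → (f [ x ↦ x' ] [ y ↦ y' ]) ε ≡ ε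
update₂-ε xv yv fε = update-ε yv (update-ε xv fε)

update₂-hit : ∀ f {x y} x' y' → x ≢ y → (f [ x ↦ x' ] [ y ↦ y' ]) x ≡ x'
update₂-hit f {x} x' y' x≢y = trans (update-miss x≢y) (update-hit f x x')

maxIndex : List Label → ℕ
maxIndex []           = 0
maxIndex (ε ∷ ls)     = maxIndex ls
maxIndex (var k ∷ ls) = k ⊔ maxIndex ls

index≤maxIndex : ∀ {k ls} → var k ∈ ls → k ≤ maxIndex ls
index≤maxIndex {ls = ε ∷ ls}     (there k∈ls) = index≤maxIndex k∈ls
index≤maxIndex {ls = var j ∷ ls} (here refl)  = m≤m⊔n _ (maxIndex ls)
index≤maxIndex {ls = var j ∷ ls} (there k∈ls) = ≤-trans (index≤maxIndex k∈ls) (m≤n⊔m j (maxIndex ls))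

var∉ : ∀ {k ls} → maxIndex ls < k → var k ∉ ls
var∉ max<k k∈ls = <-irrefl refl (≤-trans max<k (index≤maxIndex k∈ls))

freshVar₁ freshVar₂ : Seq → Label
freshVar₁ s = var (suc (maxIndex (labelsSeq s)))
freshVar₂ s = var (suc (suc (maxIndex (labelsSeq s))))

freshVar₁-fresh : ∀ s → Fresh (freshVar₁ s) s
freshVar₁-fresh s = tt , var∉ ≤-refl

freshVar₂-fresh : ∀ s → Fresh (freshVar₂ s) s
freshVar₂-fresh s = tt , var∉ (n≤1+n _)

freshVar₁≢freshVar₂ : ∀ s → freshVar₁ s ≢ freshVar₂ s
freshVar₁≢freshVar₂ s eq = 1+n≢n (sym (var-injective eq))
  where
  var-injective : ∀ {m n} → var m ≡ var n → m ≡ n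
  var-injective refl = refl

≈S-sym : ∀ {s t} → s ≈S t → t ≈S s
≈S-sym (p , q) = ↭-sym p , ↭-sym q

≈S-trans : ∀ {s t u} → s ≈S t → t ≈S u → s ≈S u
≈S-trans (p , q) (p' , q') = ↭-trans p p' , ↭-trans q q'

Deriv≤ : ℕ → Seq → Set
Deriv≤ n s = Σ (Deriv s) (λ d → ht d ≤ n)

Deriv≤-resp-≈S : ∀ {n s t} → s ≈S t → Deriv≤ n s → Deriv≤ n t
Deriv≤-resp-≈S s≈t (ax r e , h)        = ax r (≈S-trans e s≈t) , h
Deriv≤-resp-≈S s≈t (un r e d , h)      = un r (≈S-trans e s≈t) d , h
Deriv≤-resp-≈S s≈t (bin r e d₁ d₂ , h) = bin r (≈S-trans e s≈t) d₁ d₂ , h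

Deriv≤-mono : ∀ {m n s} → m ≤ n → Deriv≤ m s → Deriv≤ n s
Deriv≤-mono m≤n (d , h) = d , ≤-trans h m≤n

by-axiom : ∀ {c s} → Inst0 c → c ≈S s → Deriv≤ 1 s
by-axiom r e = ax r e , ≤-refl

by-rule₁ : ∀ {p c s n} → Inst1 p c → c ≈S s → Deriv≤ n p → Deriv≤ (suc n) s
by-rule₁ r e (d , h) = un r e d , s≤s h

by-rule₂ : ∀ {p q c s m n} → Inst2 p q c → c ≈S s → Deriv≤ m p → Deriv≤ n q → Deriv≤ (suc (m ⊔ n)) s
by-rule₂ r e (d , h) (d' , h') = bin r e d d' , s≤s (⊔-mono-≤ h h')

data Occurrence : Set where
  none  : Occurrence
  left  : Item → Occurrence
  right : LF → Occurrence

occurrenceLabels : Occurrence → List Label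
occurrenceLabels none      = []
occurrenceLabels (left φ)  = labelsItem φ
occurrenceLabels (right ψ) = labelsLF ψ

renameOccurrence : Renaming → Occurrence → Occurrence
renameOccurrence f none      = none
renameOccurrence f (left φ)  = left (renameItem f φ)
renameOccurrence f (right ψ) = right (renameLF f ψ)

-- Inverting ⊤*L is the renaming w ↦ ε.  The labels X, Y, Z of the ✶L and −✶R components are
-- arbitrary, not necessarily fresh.
data Components (f : Renaming) (Γ' : List Item) (Δ' : List LF) : Occurrence → Set where
  none    : Components f Γ' Δ' none
  ⊤*L-inv : ∀ {w} → f w ≡ ε → Components f Γ' Δ' (left (lf (w ∶ ⊤*)))
  ∧L-inv  : ∀ {w u F₁ F₂ G} → f w ≡ u → Γ' ↭ lf (u ∶ F₁) ∷ lf (u ∶ F₂) ∷ G →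
            Components f Γ' Δ' (left (lf (w ∶ F₁ ∧' F₂)))
  ⇒L-inv₁ : ∀ {w u F₁ F₂ D} → f w ≡ u → Δ' ↭ (u ∶ F₁) ∷ D →
            Components f Γ' Δ' (left (lf (w ∶ F₁ ⇒ F₂)))
  ⇒L-inv₂ : ∀ {w u F₁ F₂ G} → f w ≡ u → Γ' ↭ lf (u ∶ F₂) ∷ G →
            Components f Γ' Δ' (left (lf (w ∶ F₁ ⇒ F₂)))
  ✶L-inv  : ∀ {z u F₁ F₂ X Y G} → f z ≡ u → Γ' ↭ rel X Y u ∷ lf (X ∶ F₁) ∷ lf (Y ∶ F₂) ∷ G →
            Components f Γ' Δ' (left (lf (z ∶ F₁ ✶ F₂)))
  ⇒R-inv  : ∀ {w u F₁ F₂ G D} → f w ≡ u → Γ' ↭ lf (u ∶ F₁) ∷ G → Δ' ↭ (u ∶ F₂) ∷ D →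
            Components f Γ' Δ' (right (w ∶ F₁ ⇒ F₂))
  ∧R-inv₁ : ∀ {w u F₁ F₂ D} → f w ≡ u → Δ' ↭ (u ∶ F₁) ∷ D →
            Components f Γ' Δ' (right (w ∶ F₁ ∧' F₂))
  ∧R-inv₂ : ∀ {w u F₁ F₂ D} → f w ≡ u → Δ' ↭ (u ∶ F₂) ∷ D →
            Components f Γ' Δ' (right (w ∶ F₁ ∧' F₂))
  −✶R-inv : ∀ {y u F₁ F₂ X Z G D} → f y ≡ u → Γ' ↭ rel X u Z ∷ lf (X ∶ F₁) ∷ G → Δ' ↭ (Z ∶ F₂) ∷ D →
            Components f Γ' Δ' (right (y ∶ F₁ −✶ F₂))

Components-local : ∀ {f g Γ' Δ' o} → AgreeOn (occurrenceLabels o) f g →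
                   Components f Γ' Δ' o → Components g Γ' Δ' o
Components-local agree none            = none
Components-local agree (⊤*L-inv e)     = ⊤*L-inv (trans (sym (agree (here refl))) e)
Components-local agree (∧L-inv e p)    = ∧L-inv (trans (sym (agree (here refl))) e) p
Components-local agree (⇒L-inv₁ e p)   = ⇒L-inv₁ (trans (sym (agree (here refl))) e) p
Components-local agree (⇒L-inv₂ e p)   = ⇒L-inv₂ (trans (sym (agree (here refl))) e) p
Components-local agree (✶L-inv e p)    = ✶L-inv (trans (sym (agree (here refl))) e) p
Components-local agree (⇒R-inv e p q)  = ⇒R-inv (trans (sym (agree (here refl))) e) p q
Components-local agree (∧R-inv₁ e p)   = ∧R-inv₁ (trans (sym (agree (here refl))) e) p
Components-local agree (∧R-inv₂ e p)   = ∧R-inv₂ (trans (sym (agree (here refl))) e) p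
Components-local agree (−✶R-inv e p q) = −✶R-inv (trans (sym (agree (here refl))) e) p q

Components-weaken : ∀ {f Γ' Δ' o} X Y → Components f Γ' Δ' o → Components f (X ++ Γ') (Y ++ Δ') o
Components-weaken X Y none            = none
Components-weaken X Y (⊤*L-inv e)     = ⊤*L-inv e
Components-weaken X Y (∧L-inv e p)    = ∧L-inv e (↭-trans (++⁺ˡ X p) (shifts X (_ ∷ _ ∷ [])))
Components-weaken X Y (⇒L-inv₁ e p)   = ⇒L-inv₁ e (↭-trans (++⁺ˡ Y p) (shift _ Y _))
Components-weaken X Y (⇒L-inv₂ e p)   = ⇒L-inv₂ e (↭-trans (++⁺ˡ X p) (shift _ X _))
Components-weaken X Y (✶L-inv e p)    = ✶L-inv e (↭-trans (++⁺ˡ X p) (shifts X (_ ∷ _ ∷ _ ∷ [])))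
Components-weaken X Y (⇒R-inv e p q)  =
  ⇒R-inv e (↭-trans (++⁺ˡ X p) (shift _ X _)) (↭-trans (++⁺ˡ Y q) (shift _ Y _))
Components-weaken X Y (∧R-inv₁ e p)   = ∧R-inv₁ e (↭-trans (++⁺ˡ Y p) (shift _ Y _))
Components-weaken X Y (∧R-inv₂ e p)   = ∧R-inv₂ e (↭-trans (++⁺ˡ Y p) (shift _ Y _))
Components-weaken X Y (−✶R-inv e p q) =
  −✶R-inv e (↭-trans (++⁺ˡ X p) (shifts X (_ ∷ _ ∷ []))) (↭-trans (++⁺ˡ Y q) (shift _ Y _))

Components-rename : ∀ {f g Γ' Δ' o} τ ρ → (∀ l → g (τ l) ≡ ρ (f l)) → ρ ε ≡ ε →
                    Components f Γ' Δ' o →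
                    Components g (renameAnt ρ Γ') (renameSuc ρ Δ') (renameOccurrence τ o)
Components-rename τ ρ comm ρε none = none
Components-rename τ ρ comm ρε (⊤*L-inv {w} e)     = ⊤*L-inv (trans (comm w) (trans (cong ρ e) ρε))
Components-rename τ ρ comm ρε (∧L-inv {w} e p)    = ∧L-inv (trans (comm w) (cong ρ e)) (map⁺ _ p)
Components-rename τ ρ comm ρε (⇒L-inv₁ {w} e p)   = ⇒L-inv₁ (trans (comm w) (cong ρ e)) (map⁺ _ p)
Components-rename τ ρ comm ρε (⇒L-inv₂ {w} e p)   = ⇒L-inv₂ (trans (comm w) (cong ρ e)) (map⁺ _ p)
Components-rename τ ρ comm ρε (✶L-inv {z} e p)    = ✶L-inv (trans (comm z) (cong ρ e)) (map⁺ _ p)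
Components-rename τ ρ comm ρε (⇒R-inv {w} e p q)  =
  ⇒R-inv (trans (comm w) (cong ρ e)) (map⁺ _ p) (map⁺ _ q)
Components-rename τ ρ comm ρε (∧R-inv₁ {w} e p)   = ∧R-inv₁ (trans (comm w) (cong ρ e)) (map⁺ _ p)
Components-rename τ ρ comm ρε (∧R-inv₂ {w} e p)   = ∧R-inv₂ (trans (comm w) (cong ρ e)) (map⁺ _ p)
Components-rename τ ρ comm ρε (−✶R-inv {y} e p q) =
  −✶R-inv (trans (comm y) (cong ρ e)) (map⁺ _ p) (map⁺ _ q)

data Removal : Occurrence → List Item → List LF → List Item → List LF → Set where
  none  : ∀ {Γ Δ} → Removal none Γ Δ Γ Δ
  left  : ∀ {φ Γ Δ Γ₀} → Γ ↭ φ ∷ Γ₀ → Removal (left φ) Γ Δ Γ₀ Δ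
  right : ∀ {ψ Γ Δ Δ₀} → Δ ↭ ψ ∷ Δ₀ → Removal (right ψ) Γ Δ Γ Δ₀

Removal-prefix : ∀ {o Γ Δ Γ₀ Δ₀} X Y → Removal o Γ Δ Γ₀ Δ₀ → Removal o (X ++ Γ) (Y ++ Δ) (X ++ Γ₀) (Y ++ Δ₀)
Removal-prefix X Y none      = none
Removal-prefix X Y (left p)  = left (↭-trans (++⁺ˡ X p) (shift _ X _))
Removal-prefix X Y (right p) = right (↭-trans (++⁺ˡ Y p) (shift _ Y _))

Removal-rename : ∀ {o Γ Δ Γ₀ Δ₀} f → Removal o Γ Δ Γ₀ Δ₀ →
                 Removal (renameOccurrence f o) (renameAnt f Γ) (renameSuc f Δ) (renameAnt f Γ₀) (renameSuc f Δ₀)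
Removal-rename f none      = none
Removal-rename f (left p)  = left (map⁺ _ p)
Removal-rename f (right p) = right (map⁺ _ p)

Variant : Renaming → List Item → List LF → List Item → List LF → Seq
Variant f Γ' Δ' Γ₀ Δ₀ = Γ' ++ renameAnt f Γ₀ ⊢ Δ' ++ renameSuc f Δ₀

prepend : List Item → List LF → Seq → Seq
prepend X Y (Γ ⊢ Δ) = X ++ Γ ⊢ Y ++ Δ

labelsSeq-prepend : ∀ P Q Γ Δ → labelsSeq (Γ ⊢ Δ) ⊆ labelsSeq (prepend P Q (Γ ⊢ Δ))
labelsSeq-prepend P Q Γ Δ = ⊆-++⁺ (concatMap⁺ labelsItem (xs⊆ys++xs Γ P)) (concatMap⁺ labelsLF (xs⊆ys++xs Δ Q))

prepend-resp-≈S : ∀ X Y {S T} → S ≈S T → prepend X Y S ≈S prepend X Y T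
prepend-resp-≈S X Y (p , q) = ++⁺ˡ X p , ++⁺ˡ Y q

variant-resp-↭ : ∀ f Γ' Δ' {Γ₀ Δ₀ Γ₁ Δ₁} → Γ₀ ↭ Γ₁ → Δ₀ ↭ Δ₁ → Variant f Γ' Δ' Γ₀ Δ₀ ≈S Variant f Γ' Δ' Γ₁ Δ₁
variant-resp-↭ f Γ' Δ' p q = ++⁺ˡ Γ' (map⁺ _ p) , ++⁺ˡ Δ' (map⁺ _ q)

variant-front : ∀ f X Y Γ' Δ' K D →
                Variant f Γ' Δ' (X ++ K) (Y ++ D) ≈S prepend (renameAnt f X) (renameSuc f Y) (Variant f Γ' Δ' K D)
variant-front f X Y Γ' Δ' K D =
  ↭-trans (++⁺ˡ Γ' (↭-reflexive (map-++ _ X K))) (shifts Γ' (renameAnt f X)) ,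
  ↭-trans (++⁺ˡ Δ' (↭-reflexive (map-++ _ Y D))) (shifts Δ' (renameSuc f Y))

variant-absorb : ∀ {g τ} → (∀ l → g (τ l) ≡ g l) → ∀ Γ' Δ' K D →
                 Variant g Γ' Δ' (renameAnt τ K) (renameSuc τ D) ≡ Variant g Γ' Δ' K D
variant-absorb {g} {τ} absorbed Γ' Δ' K D =
  cong₂ _⊢_ (cong (Γ' ++_) (trans (sym (renameAnt-∘ g τ K)) (map-cong (renameItem-cong absorbed) K)))
            (cong (Δ' ++_) (trans (sym (renameSuc-∘ g τ D)) (map-cong (renameLF-cong absorbed) D)))

variant-rename : ∀ ρ f Γ' Δ' K D →
                 Variant (ρ ∘ f) (renameAnt ρ Γ') (renameSuc ρ Δ') K D ≡ renameSeq ρ (Variant f Γ' Δ' K D)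
variant-rename ρ f Γ' Δ' K D =
  cong₂ _⊢_ (trans (cong (renameAnt ρ Γ' ++_) (renameAnt-∘ ρ f K)) (sym (map-++ _ Γ' _)))
            (trans (cong (renameSuc ρ Δ' ++_) (renameSuc-∘ ρ f D)) (sym (map-++ _ Δ' _)))

Removal-local : ∀ {o Γ Δ Γ₀ Δ₀ f g} → Removal o Γ Δ Γ₀ Δ₀ → AgreeOn (labelsSeq (Γ ⊢ Δ)) f g →
                AgreeOn (occurrenceLabels o) f g × (∀ Γ' Δ' → Variant f Γ' Δ' Γ₀ Δ₀ ≡ Variant g Γ' Δ' Γ₀ Δ₀)
Removal-local {Γ = Γ} r agree = agree ∘ occurrence r , λ Γ' Δ' →
  cong₂ _⊢_ (cong (Γ' ++_) (renameAnt-local _ (agree ∘ ∈-++⁺ˡ ∘ concatMap⁺ labelsItem (remainderˡ r))))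
            (cong (Δ' ++_) (renameSuc-local _ (agree ∘ ∈-++⁺ʳ (labelsAnt Γ) ∘ concatMap⁺ labelsLF (remainderʳ r))))
  where
  occurrence : ∀ {o Γ Δ Γ₀ Δ₀} → Removal o Γ Δ Γ₀ Δ₀ → occurrenceLabels o ⊆ labelsSeq (Γ ⊢ Δ)
  occurrence none      ()
  occurrence (left p)  = ∈-++⁺ˡ ∘ labelsItem⊆labelsAnt (∈-resp-↭ (↭-sym p) (here refl))
  occurrence {Γ = Γ} (right p) = ∈-++⁺ʳ (labelsAnt Γ) ∘ labelsLF⊆labelsSuc (∈-resp-↭ (↭-sym p) (here refl))
  remainderˡ : ∀ {o Γ Δ Γ₀ Δ₀} → Removal o Γ Δ Γ₀ Δ₀ → Γ₀ ⊆ Γ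
  remainderˡ none      = λ m → m
  remainderˡ (left p)  = ∈-resp-↭ (↭-sym p) ∘ there
  remainderˡ (right p) = λ m → m
  remainderʳ : ∀ {o Γ Δ Γ₀ Δ₀} → Removal o Γ Δ Γ₀ Δ₀ → Δ₀ ⊆ Δ
  remainderʳ none      = λ m → m
  remainderʳ (left p)  = λ m → m
  remainderʳ (right p) = ∈-resp-↭ (↭-sym p) ∘ there

data Context (o : Occurrence) (Γ₀ : List Item) (Δ₀ : List LF) (P : List Item) (Q : List LF)
             (Γc : List Item) (Δc : List LF) : Set where
  context : ∀ {K D} → Removal o Γc Δc K D → Γ₀ ↭ P ++ K → Δ₀ ↭ Q ++ D → Context o Γ₀ Δ₀ P Q Γc Δc

data Split (o : Occurrence) (Γ₀ : List Item) (Δ₀ : List LF) (P : List Item) (Q : List LF)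
           (Γc : List Item) (Δc : List LF) : Set where
  principalˡ : ∀ {φ} → o ≡ left φ → φ ∈ P → Split o Γ₀ Δ₀ P Q Γc Δc
  principalʳ : ∀ {ψ} → o ≡ right ψ → ψ ∈ Q → Split o Γ₀ Δ₀ P Q Γc Δc
  inContext  : Context o Γ₀ Δ₀ P Q Γc Δc → Split o Γ₀ Δ₀ P Q Γc Δc

remove-from-context : ∀ {B : Set} {φ : B} P {Γc Γ Γ₀} → Γ ↭ φ ∷ Γ₀ → P ++ Γc ↭ Γ → φ ∈ Γc →
                      Σ (List B) λ K → (Γc ↭ φ ∷ K) × (Γ₀ ↭ P ++ K)
remove-from-context {φ = φ} P p e φ∈Γc with ∈-∃++ φ∈Γc
... | h , t , refl = h ++ t , shift φ h t ,
      drop-∷ (↭-trans (↭-sym p) (↭-trans (↭-sym e) (↭-trans (++⁺ˡ P (shift φ h t)) (shift φ P (h ++ t)))))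

split : ∀ {o Γ Δ Γ₀ Δ₀} P Q {Γc Δc} → Removal o Γ Δ Γ₀ Δ₀ → (P ++ Γc ⊢ Q ++ Δc) ≈S (Γ ⊢ Δ) →
        Split o Γ₀ Δ₀ P Q Γc Δc
split P Q none (e₁ , e₂) = inContext (context none (↭-sym e₁) (↭-sym e₂))
split P Q (left p) (e₁ , e₂) with ∈-++⁻ P (∈-resp-↭ (↭-sym e₁) (∈-resp-↭ (↭-sym p) (here refl)))
... | inj₁ φ∈P  = principalˡ refl φ∈P
... | inj₂ φ∈Γc with remove-from-context P p e₁ φ∈Γc
...   | K , q , r = inContext (context (left q) r (↭-sym e₂))
split P Q (right p) (e₁ , e₂) with ∈-++⁻ Q (∈-resp-↭ (↭-sym e₂) (∈-resp-↭ (↭-sym p) (here refl)))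
... | inj₁ ψ∈Q  = principalʳ refl ψ∈Q
... | inj₂ ψ∈Δc with remove-from-context Q p e₂ ψ∈Δc
...   | D , q , r = inContext (context (right q) (↭-sym e₁) r)

Inert : Occurrence → Set
Inert o = ∀ {f Γ' Δ'} → ¬ Components f Γ' Δ' o

context-only : ∀ {f Γ' Δ' o Γ₀ Δ₀ P Q Γc Δc} → (∀ {φ} → φ ∈ P → Inert (left φ)) → (∀ {ψ} → ψ ∈ Q → Inert (right ψ)) →
               Components f Γ' Δ' o → Split o Γ₀ Δ₀ P Q Γc Δc → Context o Γ₀ Δ₀ P Q Γc Δc
context-only inertP inertQ k (principalˡ refl φ∈P) = ⊥-elim (inertP φ∈P k)
context-only inertP inertQ k (principalʳ refl ψ∈Q) = ⊥-elim (inertQ ψ∈Q k)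
context-only inertP inertQ k (inContext c)         = c

Variants : ℕ → Seq → Set
Variants n s = ∀ f → f ε ≡ ε → ∀ {Γ' Δ' o Γ₀ Δ₀} → Components f Γ' Δ' o → Removal o (ant s) (succ s) Γ₀ Δ₀ →
               Deriv≤ n (Variant f Γ' Δ' Γ₀ Δ₀)

premise-variant : ∀ {n f Γ' Δ' o K D} X Y {Γc Δc} → Variants n (X ++ Γc ⊢ Y ++ Δc) → f ε ≡ ε →
                  Components f Γ' Δ' o → Removal o Γc Δc K D →
                  Deriv≤ n (prepend (renameAnt f X) (renameSuc f Y) (Variant f Γ' Δ' K D))
premise-variant {f = f} {Γ'} {Δ'} {K = K} {D} X Y ih fε k r =
  Deriv≤-resp-≈S (variant-front f X Y Γ' Δ' K D) (ih f fε k (Removal-prefix X Y r))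

premise-variant-local : ∀ {n f g Γ' Δ' o K D} X Y {Γc Δc} → AgreeOn (labelsSeq (Γc ⊢ Δc)) g f → g ε ≡ ε →
                        Variants n (X ++ Γc ⊢ Y ++ Δc) → Components f Γ' Δ' o → Removal o Γc Δc K D →
                        Deriv≤ n (prepend (renameAnt g X) (renameSuc g Y) (Variant f Γ' Δ' K D))
premise-variant-local {g = g} {Γ'} {Δ'} X Y agree gε ih k r with Removal-local r agree
... | agreeₒ , same = subst (Deriv≤ _ ∘ prepend (renameAnt g X) (renameSuc g Y)) (same Γ' Δ')
                        (premise-variant X Y ih gε (Components-local (sym ∘ agreeₒ) k) r)

premise-variant-subst : ∀ {n f Γ' Δ' o K D} X y x ρ {Γc Δc} →
                        Variants n (X ++ substCtx y x Γc ⊢ substSuc y x Δc) → ρ ε ≡ ε → f ε ≡ ε →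
                        ρ (f y) ≡ ρ (f x) → Components f Γ' Δ' o → Removal o Γc Δc K D →
                        Deriv≤ n (prepend (renameAnt (ρ ∘ f) X) [] (renameSeq ρ (Variant f Γ' Δ' K D)))
premise-variant-subst {n} {f} {Γ'} {Δ'} {K = K} {D} X y x ρ {Γc} {Δc} ih ρε fε ρfy≡ρfx k r =
  subst (Deriv≤ n ∘ prepend (renameAnt (ρ ∘ f) X) [])
        (trans (variant-absorb absorbed (renameAnt ρ Γ') (renameSuc ρ Δ') K D) (variant-rename ρ f Γ' Δ' K D))
        (premise-variant X [] (subst (Variants n ∘ prepend X []) (substSeq-rename y x Γc Δc) ih)
          (trans (cong ρ fε) ρε) (Components-rename (substL y x) ρ absorbed ρε k) (Removal-rename (substL y x) r))
  where
  absorbed : ∀ l → ρ (f (substL y x l)) ≡ ρ (f l)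
  absorbed = substL-absorbed (ρ ∘ f) ρfy≡ρfx

premise-variant-absorb : ∀ {n f Γ' Δ' o K D} X y x {Γc Δc} →
                         Variants n (X ++ substCtx y x Γc ⊢ substSuc y x Δc) → f ε ≡ ε → f y ≡ f x →
                         Components f Γ' Δ' o → Removal o Γc Δc K D →
                         Deriv≤ n (prepend (renameAnt f X) [] (Variant f Γ' Δ' K D))
premise-variant-absorb {n} {f} X y x ih fε fy≡fx k r =
  subst (Deriv≤ n) (cong₂ (λ A S → prepend A [] S) (map-cong (renameItem-cong (substL-trivial ε ∘ f)) X)
                                                   (renameSeq-trivial ε _ _))
        (premise-variant-subst X y x (substL ε ε) ih refl fε (cong (substL ε ε) fy≡fx) k r)

context-conclusion : ∀ f Γ' Δ' P Q {Γ₀ Δ₀ K D} → Γ₀ ↭ P ++ K → Δ₀ ↭ Q ++ D →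
                     prepend (renameAnt f P) (renameSuc f Q) (Variant f Γ' Δ' K D) ≈S Variant f Γ' Δ' Γ₀ Δ₀
context-conclusion f Γ' Δ' P Q {K = K} {D} p q =
  ≈S-trans (≈S-sym (variant-front f P Q Γ' Δ' K D)) (variant-resp-↭ f Γ' Δ' (↭-sym p) (↭-sym q))

principal-variant : ∀ f X' Y' {Γ' Δ' G D' Γc Δc Γ₀ Δ₀} → Γ' ↭ X' ++ G → Δ' ↭ Y' ++ D' → Γc ↭ Γ₀ → Δc ↭ Δ₀ →
                    prepend X' Y' (Variant f G D' Γc Δc) ≈S Variant f Γ' Δ' Γ₀ Δ₀
principal-variant f X' Y' {G = G} {D'} p q r s =
  ↭-trans (↭-reflexive (sym (++-assoc X' G _))) (++⁺ (↭-sym p) (map⁺ _ r)) ,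
  ↭-trans (↭-reflexive (sym (++-assoc Y' D' _))) (++⁺ (↭-sym q) (map⁺ _ s))

variants-axiom : ∀ {c s} → Inst0 c → c ≈S s → Variants 1 s
variants-axiom (id {w = w} {p}) e f fε {Γ'} {Δ'} k r
  with context-only (λ { (here refl) () ; (there ()) }) (λ { (here refl) () ; (there ()) }) k
                    (split (lf (w ∶ atom p) ∷ []) ((w ∶ atom p) ∷ []) r e)
... | context _ g₁ g₂ = by-axiom id (context-conclusion f Γ' Δ' (lf (w ∶ atom p) ∷ []) ((w ∶ atom p) ∷ []) g₁ g₂)
variants-axiom (⊥L {w = w}) e f fε {Γ'} {Δ'} k r
  with context-only (λ { (here refl) () ; (there ()) }) (λ ()) k (split (lf (w ∶ ⊥') ∷ []) [] r e)
... | context _ g₁ g₂ = by-axiom ⊥L (context-conclusion f Γ' Δ' (lf (w ∶ ⊥') ∷ []) [] g₁ g₂)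
variants-axiom (⊤R {w = w}) e f fε {Γ'} {Δ'} k r
  with context-only (λ ()) (λ { (here refl) () ; (there ()) }) k (split [] ((w ∶ ⊤') ∷ []) r e)
... | context _ g₁ g₂ = by-axiom ⊤R (context-conclusion f Γ' Δ' [] ((w ∶ ⊤') ∷ []) g₁ g₂)
variants-axiom ⊤*R e f fε {Γ'} {Δ'} {Γ₀ = Γ₀} {Δ₀} k r
  with context-only (λ ()) (λ { (here refl) () ; (there ()) }) k (split [] ((ε ∶ ⊤*) ∷ []) r e)
... | context {K} {D} _ g₁ g₂ =
  by-axiom ⊤*R (subst (λ u → prepend [] ((u ∶ ⊤*) ∷ []) (Variant f Γ' Δ' K D) ≈S Variant f Γ' Δ' Γ₀ Δ₀) fε
                      (context-conclusion f Γ' Δ' [] ((ε ∶ ⊤*) ∷ []) g₁ g₂))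

variants-∧L : ∀ {Γc Δc w F₁ F₂ s n} → (lf (w ∶ F₁ ∧' F₂) ∷ Γc ⊢ Δc) ≈S s →
              Variants n (lf (w ∶ F₁) ∷ lf (w ∶ F₂) ∷ Γc ⊢ Δc) → Variants (suc n) s
variants-∧L {w = w} {F₁} {F₂} e@(e₁ , e₂) ih f fε {Γ'} {Δ'} k r with split (lf (w ∶ F₁ ∧' F₂) ∷ []) [] r e
... | principalˡ refl (there ())
... | principalʳ refl ()
... | principalˡ refl (here refl) with k | r
...   | ∧L-inv refl p | left q =
  Deriv≤-mono (n≤1+n _) (Deriv≤-resp-≈S
    (principal-variant f (lf (f w ∶ F₁) ∷ lf (f w ∶ F₂) ∷ []) [] p ↭-refl (drop-∷ (↭-trans e₁ q)) e₂)
    (premise-variant (lf (w ∶ F₁) ∷ lf (w ∶ F₂) ∷ []) [] ih fε none none))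
variants-∧L {w = w} {F₁} {F₂} e ih f fε {Γ'} {Δ'} k r | inContext (context r' g₁ g₂) =
  by-rule₁ ∧L (context-conclusion f Γ' Δ' (lf (w ∶ F₁ ∧' F₂) ∷ []) [] g₁ g₂)
    (premise-variant (lf (w ∶ F₁) ∷ lf (w ∶ F₂) ∷ []) [] ih fε k r')

variants-⇒R : ∀ {Γc Δc w F₁ F₂ s n} → (Γc ⊢ (w ∶ F₁ ⇒ F₂) ∷ Δc) ≈S s →
              Variants n (lf (w ∶ F₁) ∷ Γc ⊢ (w ∶ F₂) ∷ Δc) → Variants (suc n) s
variants-⇒R {w = w} {F₁} {F₂} e@(e₁ , e₂) ih f fε {Γ'} {Δ'} k r with split [] ((w ∶ F₁ ⇒ F₂) ∷ []) r e
... | principalˡ refl ()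
... | principalʳ refl (there ())
... | principalʳ refl (here refl) with k | r
...   | ⇒R-inv refl p q | right q' =
  Deriv≤-mono (n≤1+n _) (Deriv≤-resp-≈S
    (principal-variant f (lf (f w ∶ F₁) ∷ []) ((f w ∶ F₂) ∷ []) p q e₁ (drop-∷ (↭-trans e₂ q')))
    (premise-variant (lf (w ∶ F₁) ∷ []) ((w ∶ F₂) ∷ []) ih fε none none))
variants-⇒R {w = w} {F₁} {F₂} e ih f fε {Γ'} {Δ'} k r | inContext (context r' g₁ g₂) =
  by-rule₁ ⇒R (context-conclusion f Γ' Δ' [] ((w ∶ F₁ ⇒ F₂) ∷ []) g₁ g₂)
    (premise-variant (lf (w ∶ F₁) ∷ []) ((w ∶ F₂) ∷ []) ih fε k r')

variants-✶L : ∀ {Γc Δc x y z F₁ F₂ s n} →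
              Fresh x (lf (z ∶ F₁ ✶ F₂) ∷ Γc ⊢ Δc) → Fresh y (lf (z ∶ F₁ ✶ F₂) ∷ Γc ⊢ Δc) → x ≢ y →
              (lf (z ∶ F₁ ✶ F₂) ∷ Γc ⊢ Δc) ≈S s →
              Variants n (rel x y z ∷ lf (x ∶ F₁) ∷ lf (y ∶ F₂) ∷ Γc ⊢ Δc) → Variants (suc n) s
variants-✶L {Γc} {Δc} {x} {y} {z} {F₁} {F₂} {n = n} x♯ y♯ x≢y e@(e₁ , e₂) ih f fε {Γ'} {Δ'} k r
  with split (lf (z ∶ F₁ ✶ F₂) ∷ []) [] r e
... | principalˡ refl (there ())
... | principalʳ refl ()
... | principalˡ refl (here refl) with k | r
...   | ✶L-inv {X = X} {Y} refl p | left q =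
  Deriv≤-mono (n≤1+n _) (Deriv≤-resp-≈S
    (principal-variant f (rel X Y (f z) ∷ lf (X ∶ F₁) ∷ lf (Y ∶ F₂) ∷ []) [] p ↭-refl (drop-∷ (↭-trans e₁ q)) e₂)
    (relabel (update₂-hit f X Y x≢y) (update-hit _ y Y) (agree (here refl))
      (premise-variant-local eigen [] (agree ∘ labelsSeq-prepend (lf (z ∶ F₁ ✶ F₂) ∷ []) [] Γc Δc)
        (update₂-ε (proj₁ x♯) (proj₁ y♯) fε) ih none none)))
  where
  eigen = rel x y z ∷ lf (x ∶ F₁) ∷ lf (y ∶ F₂) ∷ []
  agree : AgreeOn (labelsSeq (lf (z ∶ F₁ ✶ F₂) ∷ Γc ⊢ Δc)) (f [ x ↦ X ] [ y ↦ Y ]) f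
  agree = update₂-fresh (lf (z ∶ F₁ ✶ F₂) ∷ Γc ⊢ Δc) x♯ y♯
  relabel : ∀ {a b c S} → a ≡ X → b ≡ Y → c ≡ f z → Deriv≤ n (prepend (rel a b c ∷ lf (a ∶ F₁) ∷ lf (b ∶ F₂) ∷ []) [] S) →
            Deriv≤ n (prepend (rel X Y (f z) ∷ lf (X ∶ F₁) ∷ lf (Y ∶ F₂) ∷ []) [] S)
  relabel refl refl refl d = d
variants-✶L {Γc} {Δc} {x} {y} {z} {F₁} {F₂} {n = n} x♯ y♯ x≢y e ih f fε {Γ'} {Δ'} k r
  | inContext (context {K} {D} r' g₁ g₂) =
  by-rule₁ (✶L (freshVar₁-fresh S) (freshVar₂-fresh S) (freshVar₁≢freshVar₂ S))
    (context-conclusion f Γ' Δ' (lf (z ∶ F₁ ✶ F₂) ∷ []) [] g₁ g₂)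
    (relabel (update₂-hit f x' y' x≢y) (update-hit _ y y') (agree (here refl))
      (premise-variant-local eigen [] (agree ∘ labelsSeq-prepend (lf (z ∶ F₁ ✶ F₂) ∷ []) [] Γc Δc)
        (update₂-ε (proj₁ x♯) (proj₁ y♯) fε) ih k r'))
  where
  S  = prepend (lf (f z ∶ F₁ ✶ F₂) ∷ []) [] (Variant f Γ' Δ' K D)
  x' = freshVar₁ S
  y' = freshVar₂ S
  eigen = rel x y z ∷ lf (x ∶ F₁) ∷ lf (y ∶ F₂) ∷ []
  agree : AgreeOn (labelsSeq (lf (z ∶ F₁ ✶ F₂) ∷ Γc ⊢ Δc)) (f [ x ↦ x' ] [ y ↦ y' ]) f
  agree = update₂-fresh (lf (z ∶ F₁ ✶ F₂) ∷ Γc ⊢ Δc) x♯ y♯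
  relabel : ∀ {a b c} → a ≡ x' → b ≡ y' → c ≡ f z →
            Deriv≤ n (prepend (rel a b c ∷ lf (a ∶ F₁) ∷ lf (b ∶ F₂) ∷ []) [] (Variant f Γ' Δ' K D)) →
            Deriv≤ n (prepend (rel x' y' (f z) ∷ lf (x' ∶ F₁) ∷ lf (y' ∶ F₂) ∷ []) [] (Variant f Γ' Δ' K D))
  relabel refl refl refl d = d

variants-−✶R : ∀ {Γc Δc x y z F₁ F₂ s n} →
               Fresh x (Γc ⊢ (y ∶ F₁ −✶ F₂) ∷ Δc) → Fresh z (Γc ⊢ (y ∶ F₁ −✶ F₂) ∷ Δc) → x ≢ z →
               (Γc ⊢ (y ∶ F₁ −✶ F₂) ∷ Δc) ≈S s →
               Variants n (rel x y z ∷ lf (x ∶ F₁) ∷ Γc ⊢ (z ∶ F₂) ∷ Δc) → Variants (suc n) s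
variants-−✶R {Γc} {Δc} {x} {y} {z} {F₁} {F₂} {n = n} x♯ z♯ x≢z e@(e₁ , e₂) ih f fε {Γ'} {Δ'} k r
  with split [] ((y ∶ F₁ −✶ F₂) ∷ []) r e
... | principalˡ refl ()
... | principalʳ refl (there ())
... | principalʳ refl (here refl) with k | r
...   | −✶R-inv {X = X} {Z} refl p q | right q' =
  Deriv≤-mono (n≤1+n _) (Deriv≤-resp-≈S
    (principal-variant f (rel X (f y) Z ∷ lf (X ∶ F₁) ∷ []) ((Z ∶ F₂) ∷ []) p q e₁ (drop-∷ (↭-trans e₂ q')))
    (relabel (update₂-hit f X Z x≢z) (agree (∈-++⁺ʳ (labelsAnt Γc) (here refl))) (update-hit _ z Z)
      (premise-variant-local (rel x y z ∷ lf (x ∶ F₁) ∷ []) ((z ∶ F₂) ∷ [])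
        (agree ∘ labelsSeq-prepend [] ((y ∶ F₁ −✶ F₂) ∷ []) Γc Δc) (update₂-ε (proj₁ x♯) (proj₁ z♯) fε) ih none none)))
  where
  agree : AgreeOn (labelsSeq (Γc ⊢ (y ∶ F₁ −✶ F₂) ∷ Δc)) (f [ x ↦ X ] [ z ↦ Z ]) f
  agree = update₂-fresh (Γc ⊢ (y ∶ F₁ −✶ F₂) ∷ Δc) x♯ z♯
  relabel : ∀ {a b c S} → a ≡ X → b ≡ f y → c ≡ Z → Deriv≤ n (prepend (rel a b c ∷ lf (a ∶ F₁) ∷ []) ((c ∶ F₂) ∷ []) S) →
            Deriv≤ n (prepend (rel X (f y) Z ∷ lf (X ∶ F₁) ∷ []) ((Z ∶ F₂) ∷ []) S)
  relabel refl refl refl d = d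
variants-−✶R {Γc} {Δc} {x} {y} {z} {F₁} {F₂} {n = n} x♯ z♯ x≢z e ih f fε {Γ'} {Δ'} k r
  | inContext (context {K} {D} r' g₁ g₂) =
  by-rule₁ (−✶R (freshVar₁-fresh S) (freshVar₂-fresh S) (freshVar₁≢freshVar₂ S))
    (context-conclusion f Γ' Δ' [] ((y ∶ F₁ −✶ F₂) ∷ []) g₁ g₂)
    (relabel (update₂-hit f x' z' x≢z) (agree (∈-++⁺ʳ (labelsAnt Γc) (here refl))) (update-hit _ z z')
      (premise-variant-local (rel x y z ∷ lf (x ∶ F₁) ∷ []) ((z ∶ F₂) ∷ [])
        (agree ∘ labelsSeq-prepend [] ((y ∶ F₁ −✶ F₂) ∷ []) Γc Δc) (update₂-ε (proj₁ x♯) (proj₁ z♯) fε) ih k r'))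
  where
  S  = prepend [] ((f y ∶ F₁ −✶ F₂) ∷ []) (Variant f Γ' Δ' K D)
  x' = freshVar₁ S
  z' = freshVar₂ S
  agree : AgreeOn (labelsSeq (Γc ⊢ (y ∶ F₁ −✶ F₂) ∷ Δc)) (f [ x ↦ x' ] [ z ↦ z' ]) f
  agree = update₂-fresh (Γc ⊢ (y ∶ F₁ −✶ F₂) ∷ Δc) x♯ z♯
  relabel : ∀ {a b c} → a ≡ x' → b ≡ f y → c ≡ z' →
            Deriv≤ n (prepend (rel a b c ∷ lf (a ∶ F₁) ∷ []) ((c ∶ F₂) ∷ []) (Variant f Γ' Δ' K D)) →
            Deriv≤ n (prepend (rel x' (f y) z' ∷ lf (x' ∶ F₁) ∷ []) ((z' ∶ F₂) ∷ []) (Variant f Γ' Δ' K D))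
  relabel refl refl refl d = d

variants-E : ∀ {Γc Δc x y z s n} → (rel x y z ∷ Γc ⊢ Δc) ≈S s →
             Variants n (rel y x z ∷ rel x y z ∷ Γc ⊢ Δc) → Variants (suc n) s
variants-E {x = x} {y} {z} e ih f fε {Γ'} {Δ'} k r
  with context-only (λ { (here refl) () ; (there ()) }) (λ ()) k (split (rel x y z ∷ []) [] r e)
... | context r' g₁ g₂ =
  by-rule₁ E (context-conclusion f Γ' Δ' (rel x y z ∷ []) [] g₁ g₂)
    (premise-variant (rel y x z ∷ rel x y z ∷ []) [] ih fε k r')

variants-U : ∀ {Γc Δc x s n} → (Γc ⊢ Δc) ≈S s → Variants n (rel x ε x ∷ Γc ⊢ Δc) → Variants (suc n) s
variants-U {x = x} e ih f fε {Γ'} {Δ'} k r with context-only (λ ()) (λ ()) k (split [] [] r e)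
... | context {K} {D} r' g₁ g₂ =
  by-rule₁ U (context-conclusion f Γ' Δ' [] [] g₁ g₂)
    (subst (λ u → Deriv≤ _ (prepend (rel (f x) u (f x) ∷ []) [] (Variant f Γ' Δ' K D))) fε
      (premise-variant (rel x ε x ∷ []) [] ih fε k r'))

variants-A : ∀ {Γc Δc x y z u v w s n} → Fresh w (rel x y z ∷ rel u v x ∷ Γc ⊢ Δc) →
             (rel x y z ∷ rel u v x ∷ Γc ⊢ Δc) ≈S s →
             Variants n (rel u w z ∷ rel y v w ∷ rel x y z ∷ rel u v x ∷ Γc ⊢ Δc) → Variants (suc n) s
variants-A {Γc} {Δc} {x} {y} {z} {u} {v} {w} {n = n} w♯ e ih f fε {Γ'} {Δ'} k r
  with context-only (λ { (here refl) () ; (there (here refl)) () ; (there (there ())) }) (λ ()) k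
                    (split (rel x y z ∷ rel u v x ∷ []) [] r e)
... | context {K} {D} r' g₁ g₂ =
  by-rule₁ (A (freshVar₁-fresh S)) (context-conclusion f Γ' Δ' P [] g₁ g₂)
    (relabel (agree (there (there (there (here refl))))) (update-hit f w w') (agree (there (there (here refl))))
             (agree (there (here refl))) (agree (there (there (there (there (here refl))))))
      (Deriv≤-resp-≈S (prepend-resp-≈S (renameAnt (f [ w ↦ w' ]) eigen) [] (variant-front f P [] Γ' Δ' K D))
        (premise-variant-local eigen [] agree (update-ε (proj₁ w♯) fε) ih k
          (Removal-prefix P [] r'))))
  where
  P  = rel x y z ∷ rel u v x ∷ []
  eigen = rel u w z ∷ rel y v w ∷ []
  S  = prepend (renameAnt f P) [] (Variant f Γ' Δ' K D)
  w' = freshVar₁ S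
  agree : AgreeOn (labelsSeq (P ++ Γc ⊢ Δc)) (f [ w ↦ w' ]) f
  agree = update-agrees (proj₂ w♯)
  relabel : ∀ {a b c d g} → a ≡ f u → b ≡ w' → c ≡ f z → d ≡ f y → g ≡ f v →
            Deriv≤ n (prepend (rel a b c ∷ rel d g b ∷ []) [] S) →
            Deriv≤ n (prepend (rel (f u) w' (f z) ∷ rel (f y) (f v) w' ∷ []) [] S)
  relabel refl refl refl refl refl d = d

variants-AC : ∀ {Γc Δc x y w s n} → Fresh w (rel x y x ∷ Γc ⊢ Δc) → (rel x y x ∷ Γc ⊢ Δc) ≈S s →
              Variants n (rel x w x ∷ rel y y w ∷ rel x y x ∷ Γc ⊢ Δc) → Variants (suc n) s
variants-AC {Γc} {Δc} {x} {y} {w} {n = n} w♯ e ih f fε {Γ'} {Δ'} k r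
  with context-only (λ { (here refl) () ; (there ()) }) (λ ()) k (split (rel x y x ∷ []) [] r e)
... | context {K} {D} r' g₁ g₂ =
  by-rule₁ (AC (freshVar₁-fresh S)) (context-conclusion f Γ' Δ' P [] g₁ g₂)
    (relabel (agree (here refl)) (update-hit f w w') (agree (there (here refl)))
      (Deriv≤-resp-≈S (prepend-resp-≈S (renameAnt (f [ w ↦ w' ]) eigen) [] (variant-front f P [] Γ' Δ' K D))
        (premise-variant-local eigen [] agree (update-ε (proj₁ w♯) fε) ih k
          (Removal-prefix P [] r'))))
  where
  P  = rel x y x ∷ []
  eigen = rel x w x ∷ rel y y w ∷ []
  S  = prepend (renameAnt f P) [] (Variant f Γ' Δ' K D)
  w' = freshVar₁ S
  agree : AgreeOn (labelsSeq (P ++ Γc ⊢ Δc)) (f [ w ↦ w' ]) f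
  agree = update-agrees (proj₂ w♯)
  relabel : ∀ {a b c} → a ≡ f x → b ≡ w' → c ≡ f y →
            Deriv≤ n (prepend (rel a b a ∷ rel c c b ∷ []) [] S) →
            Deriv≤ n (prepend (rel (f x) w' (f x) ∷ rel (f y) (f y) w' ∷ []) [] S)
  relabel refl refl refl d = d

variants-⊤*L : ∀ {Γc Δc w s n} → w ≢ ε → (lf (w ∶ ⊤*) ∷ Γc ⊢ Δc) ≈S s →
               Variants n (substCtx ε w Γc ⊢ substSuc ε w Δc) → Variants (suc n) s
variants-⊤*L {Γc} {Δc} {w} {n = n} w≢ε e@(e₁ , e₂) ih f fε {Γ'} {Δ'} k r with split (lf (w ∶ ⊤*) ∷ []) [] r e
... | principalˡ refl (there ())
... | principalʳ refl ()
... | principalˡ refl (here refl) with k | r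
...   | ⊤*L-inv fw≡ε | left q =
  Deriv≤-mono (n≤1+n _) (Deriv≤-resp-≈S (variant-resp-↭ f Γ' Δ' (drop-∷ (↭-trans e₁ q)) e₂)
    (premise-variant-absorb [] ε w ih fε (trans fε (sym fw≡ε)) none none))
variants-⊤*L {Γc} {Δc} {w} {n = n} w≢ε e ih f fε {Γ'} {Δ'} {Γ₀ = Γ₀} {Δ₀} k r | inContext (context {K} {D} r' g₁ g₂)
  with f w ≟L ε
... | yes fw≡ε =
  -- the renamed ⊤* sits at ε and is simply weakened in
  Deriv≤-mono (n≤1+n _) (Deriv≤-resp-≈S
    (subst (λ u → prepend (lf (u ∶ ⊤*) ∷ []) [] (Variant f Γ' Δ' K D) ≈S Variant f Γ' Δ' Γ₀ Δ₀) fw≡ε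
      (context-conclusion f Γ' Δ' (lf (w ∶ ⊤*) ∷ []) [] g₁ g₂))
    (premise-variant-absorb [] ε w ih fε (trans fε (sym fw≡ε)) (Components-weaken (lf (ε ∶ ⊤*) ∷ []) [] k) r'))
... | no fw≢ε =
  by-rule₁ (⊤*L fw≢ε) (context-conclusion f Γ' Δ' (lf (w ∶ ⊤*) ∷ []) [] g₁ g₂)
    (subst (Deriv≤ n) (sym (substSeq-rename ε (f w) _ _))
      (premise-variant-subst [] ε w (substL ε (f w)) ih (substL-ε fw≢ε) fε
        (trans (cong (substL ε (f w)) fε) (trans (substL-ε fw≢ε) (sym (substL-hit ε (f w))))) k r'))

eq-premise : ∀ {n f Γ' Δ' o K D w w' Γc Δc} a b →
             Variants n (rel ε w' w' ∷ substCtx w' w Γc ⊢ substSuc w' w Δc) → f ε ≡ ε →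
             substL b a ε ≡ ε → substL b a (f w') ≡ b → substL b a (f w) ≡ b →
             Components f Γ' Δ' o → Removal o Γc Δc K D →
             Deriv≤ n (rel ε b b ∷ substCtx b a (Γ' ++ renameAnt f K) ⊢ substSuc b a (Δ' ++ renameSuc f D))
eq-premise {n} {f} {Γ'} {Δ'} {K = K} {D} {w} {w'} a b ih fε ρε ρfw'≡b ρfw≡b k r =
  fix (trans (cong (substL b a) fε) ρε) ρfw'≡b (sym (substSeq-rename b a _ _))
    (premise-variant-subst (rel ε w' w' ∷ []) w' w (substL b a) ih ρε fε (trans ρfw'≡b (sym ρfw≡b)) k r)
  where
  fix : ∀ {c d S} → c ≡ ε → d ≡ b →
        S ≡ (substCtx b a (Γ' ++ renameAnt f K) ⊢ substSuc b a (Δ' ++ renameSuc f D)) →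
        Deriv≤ n (prepend (rel c d d ∷ []) [] S) →
        Deriv≤ n (rel ε b b ∷ substCtx b a (Γ' ++ renameAnt f K) ⊢ substSuc b a (Δ' ++ renameSuc f D))
  fix refl refl refl d = d

-- If f sends w to ε, the atom cannot be eliminated at f w: either f w' = ε too and the premise
-- is itself a variant of the conclusion, or the rule with the opposite orientation applies at f w'.
variants-Eq : ∀ {n f Γ' Δ' o K D w w' Γc Δc T} (eqAtom : Label → Label → Item) →
              (∀ {Γ Δ a b} → a ≢ ε → Inst1 (rel ε b b ∷ substCtx b a Γ ⊢ substSuc b a Δ) (eqAtom a b ∷ Γ ⊢ Δ)) →
              (∀ {Γ Δ a} → a ≢ ε → Inst1 (rel ε ε ε ∷ substCtx ε a Γ ⊢ substSuc ε a Δ) (eqAtom ε a ∷ Γ ⊢ Δ)) →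
              eqAtom ε ε ≡ rel ε ε ε →
              Variants n (rel ε w' w' ∷ substCtx w' w Γc ⊢ substSuc w' w Δc) → f ε ≡ ε →
              Components f Γ' Δ' o → Removal o Γc Δc K D →
              prepend (eqAtom (f w) (f w') ∷ []) [] (Variant f Γ' Δ' K D) ≈S T → Deriv≤ (suc n) T
variants-Eq {n} {f} {Γ'} {Δ'} {K = K} {D} {w} {w'} {T = T} eqAtom Eq Eq-flipped eqAtom-εε ih fε k r conclusion =
  cases (f w ≟L ε) (f w' ≟L ε)
  where
  conclusion-at : ∀ {c d} → c ≡ f w → d ≡ f w' → prepend (eqAtom c d ∷ []) [] (Variant f Γ' Δ' K D) ≈S T
  conclusion-at refl refl = conclusion
  cases : Dec (f w ≡ ε) → Dec (f w' ≡ ε) → Deriv≤ (suc n) T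
  cases (no fw≢ε) _ =
    by-rule₁ (Eq fw≢ε) conclusion
      (eq-premise (f w) (f w') ih fε (substL-ε fw≢ε) (substL-target (f w') (f w)) (substL-hit (f w') (f w)) k r)
  cases (yes fw≡ε) (yes fw'≡ε) =
    Deriv≤-mono (n≤1+n _) (Deriv≤-resp-≈S
      (subst (λ φ → prepend (φ ∷ []) [] (Variant f Γ' Δ' K D) ≈S T) eqAtom-εε (conclusion-at (sym fw≡ε) (sym fw'≡ε)))
      (subst (Deriv≤ n) (cong (prepend (rel ε ε ε ∷ []) []) (trans (substSeq-rename ε ε _ _) (renameSeq-trivial ε _ _)))
        (eq-premise ε ε ih fε refl (trans (substL-trivial ε _) fw'≡ε) (trans (substL-trivial ε _) fw≡ε) k r)))
  cases (yes fw≡ε) (no fw'≢ε) =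
    by-rule₁ (Eq-flipped fw'≢ε) (conclusion-at (sym fw≡ε) refl)
      (eq-premise (f w') ε ih fε (substL-ε fw'≢ε) (substL-hit ε (f w'))
        (trans (cong (substL ε (f w')) fw≡ε) (substL-ε fw'≢ε)) k r)

variants-Eq₁ : ∀ {Γc Δc w w' s n} → w ≢ ε → (rel ε w w' ∷ Γc ⊢ Δc) ≈S s →
               Variants n (rel ε w' w' ∷ substCtx w' w Γc ⊢ substSuc w' w Δc) → Variants (suc n) s
variants-Eq₁ {w = w} {w'} w≢ε e ih f fε {Γ'} {Δ'} {Γ₀ = Γ₀} {Δ₀} k r
  with context-only (λ { (here refl) () ; (there ()) }) (λ ()) k (split (rel ε w w' ∷ []) [] r e)
... | context {K} {D} r' g₁ g₂ =
  variants-Eq (λ a b → rel ε a b) Eq₁ Eq₂ refl ih fε k r'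
    (subst (λ u → prepend (rel u (f w) (f w') ∷ []) [] (Variant f Γ' Δ' K D) ≈S Variant f Γ' Δ' Γ₀ Δ₀) fε
      (context-conclusion f Γ' Δ' (rel ε w w' ∷ []) [] g₁ g₂))

variants-Eq₂ : ∀ {Γc Δc w w' s n} → w ≢ ε → (rel ε w' w ∷ Γc ⊢ Δc) ≈S s →
               Variants n (rel ε w' w' ∷ substCtx w' w Γc ⊢ substSuc w' w Δc) → Variants (suc n) s
variants-Eq₂ {w = w} {w'} w≢ε e ih f fε {Γ'} {Δ'} {Γ₀ = Γ₀} {Δ₀} k r
  with context-only (λ { (here refl) () ; (there ()) }) (λ ()) k (split (rel ε w' w ∷ []) [] r e)
... | context {K} {D} r' g₁ g₂ =
  variants-Eq (λ a b → rel ε b a) Eq₂ Eq₁ refl ih fε k r'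
    (subst (λ u → prepend (rel u (f w') (f w) ∷ []) [] (Variant f Γ' Δ' K D) ≈S Variant f Γ' Δ' Γ₀ Δ₀) fε
      (context-conclusion f Γ' Δ' (rel ε w' w ∷ []) [] g₁ g₂))

variants-∧R : ∀ {Γc Δc w F₁ F₂ s m n} → (Γc ⊢ (w ∶ F₁ ∧' F₂) ∷ Δc) ≈S s →
              Variants m (Γc ⊢ (w ∶ F₁) ∷ Δc) → Variants n (Γc ⊢ (w ∶ F₂) ∷ Δc) → Variants (suc (m ⊔ n)) s
variants-∧R {w = w} {F₁} {F₂} e@(e₁ , e₂) ih₁ ih₂ f fε {Γ'} {Δ'} k r with split [] ((w ∶ F₁ ∧' F₂) ∷ []) r e
... | principalˡ refl ()
... | principalʳ refl (there ())
... | principalʳ refl (here refl) with k | r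
...   | ∧R-inv₁ refl q | right q' =
  Deriv≤-mono (m≤n⇒m≤1+n (m≤m⊔n _ _)) (Deriv≤-resp-≈S
    (principal-variant f [] ((f w ∶ F₁) ∷ []) ↭-refl q e₁ (drop-∷ (↭-trans e₂ q')))
    (premise-variant [] ((w ∶ F₁) ∷ []) ih₁ fε none none))
...   | ∧R-inv₂ refl q | right q' =
  Deriv≤-mono (m≤n⇒m≤1+n (m≤n⊔m _ _)) (Deriv≤-resp-≈S
    (principal-variant f [] ((f w ∶ F₂) ∷ []) ↭-refl q e₁ (drop-∷ (↭-trans e₂ q')))
    (premise-variant [] ((w ∶ F₂) ∷ []) ih₂ fε none none))
variants-∧R {w = w} {F₁} {F₂} e ih₁ ih₂ f fε {Γ'} {Δ'} k r | inContext (context r' g₁ g₂) =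
  by-rule₂ ∧R (context-conclusion f Γ' Δ' [] ((w ∶ F₁ ∧' F₂) ∷ []) g₁ g₂)
    (premise-variant [] ((w ∶ F₁) ∷ []) ih₁ fε k r') (premise-variant [] ((w ∶ F₂) ∷ []) ih₂ fε k r')

variants-⇒L : ∀ {Γc Δc w F₁ F₂ s m n} → (lf (w ∶ F₁ ⇒ F₂) ∷ Γc ⊢ Δc) ≈S s →
              Variants m (Γc ⊢ (w ∶ F₁) ∷ Δc) → Variants n (lf (w ∶ F₂) ∷ Γc ⊢ Δc) → Variants (suc (m ⊔ n)) s
variants-⇒L {w = w} {F₁} {F₂} e@(e₁ , e₂) ih₁ ih₂ f fε {Γ'} {Δ'} k r with split (lf (w ∶ F₁ ⇒ F₂) ∷ []) [] r e
... | principalˡ refl (there ())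
... | principalʳ refl ()
... | principalˡ refl (here refl) with k | r
...   | ⇒L-inv₁ refl q | left q' =
  Deriv≤-mono (m≤n⇒m≤1+n (m≤m⊔n _ _)) (Deriv≤-resp-≈S
    (principal-variant f [] ((f w ∶ F₁) ∷ []) ↭-refl q (drop-∷ (↭-trans e₁ q')) e₂)
    (premise-variant [] ((w ∶ F₁) ∷ []) ih₁ fε none none))
...   | ⇒L-inv₂ refl p | left q' =
  Deriv≤-mono (m≤n⇒m≤1+n (m≤n⊔m _ _)) (Deriv≤-resp-≈S
    (principal-variant f (lf (f w ∶ F₂) ∷ []) [] p ↭-refl (drop-∷ (↭-trans e₁ q')) e₂)
    (premise-variant (lf (w ∶ F₂) ∷ []) [] ih₂ fε none none))
variants-⇒L {w = w} {F₁} {F₂} e ih₁ ih₂ f fε {Γ'} {Δ'} k r | inContext (context r' g₁ g₂) =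
  by-rule₂ ⇒L (context-conclusion f Γ' Δ' (lf (w ∶ F₁ ⇒ F₂) ∷ []) [] g₁ g₂)
    (premise-variant [] ((w ∶ F₁) ∷ []) ih₁ fε k r') (premise-variant (lf (w ∶ F₂) ∷ []) [] ih₂ fε k r')

variants-✶R : ∀ {Γc Δc x y z F₁ F₂ s m n} → (rel x y z ∷ Γc ⊢ (z ∶ F₁ ✶ F₂) ∷ Δc) ≈S s →
              Variants m (rel x y z ∷ Γc ⊢ (x ∶ F₁) ∷ (z ∶ F₁ ✶ F₂) ∷ Δc) →
              Variants n (rel x y z ∷ Γc ⊢ (y ∶ F₂) ∷ (z ∶ F₁ ✶ F₂) ∷ Δc) → Variants (suc (m ⊔ n)) s
variants-✶R {x = x} {y} {z} {F₁} {F₂} e ih₁ ih₂ f fε {Γ'} {Δ'} k r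
  with context-only (λ { (here refl) () ; (there ()) }) (λ { (here refl) () ; (there ()) }) k
                    (split (rel x y z ∷ []) ((z ∶ F₁ ✶ F₂) ∷ []) r e)
... | context r' g₁ g₂ =
  by-rule₂ ✶R (context-conclusion f Γ' Δ' (rel x y z ∷ []) ((z ∶ F₁ ✶ F₂) ∷ []) g₁ g₂)
    (premise-variant (rel x y z ∷ []) ((x ∶ F₁) ∷ (z ∶ F₁ ✶ F₂) ∷ []) ih₁ fε k r')
    (premise-variant (rel x y z ∷ []) ((y ∶ F₂) ∷ (z ∶ F₁ ✶ F₂) ∷ []) ih₂ fε k r')

variants-−✶L : ∀ {Γc Δc x y z F₁ F₂ s m n} → (rel x y z ∷ lf (y ∶ F₁ −✶ F₂) ∷ Γc ⊢ Δc) ≈S s →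
               Variants m (rel x y z ∷ lf (y ∶ F₁ −✶ F₂) ∷ Γc ⊢ (x ∶ F₁) ∷ Δc) →
               Variants n (rel x y z ∷ lf (y ∶ F₁ −✶ F₂) ∷ lf (z ∶ F₂) ∷ Γc ⊢ Δc) → Variants (suc (m ⊔ n)) s
variants-−✶L {x = x} {y} {z} {F₁} {F₂} e ih₁ ih₂ f fε {Γ'} {Δ'} k r
  with context-only (λ { (here refl) () ; (there (here refl)) () ; (there (there ())) }) (λ ()) k
                    (split (rel x y z ∷ lf (y ∶ F₁ −✶ F₂) ∷ []) [] r e)
... | context r' g₁ g₂ =
  by-rule₂ −✶L (context-conclusion f Γ' Δ' (rel x y z ∷ lf (y ∶ F₁ −✶ F₂) ∷ []) [] g₁ g₂)
    (premise-variant (rel x y z ∷ lf (y ∶ F₁ −✶ F₂) ∷ []) ((x ∶ F₁) ∷ []) ih₁ fε k r')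
    (premise-variant (rel x y z ∷ lf (y ∶ F₁ −✶ F₂) ∷ lf (z ∶ F₂) ∷ []) [] ih₂ fε k r')

variants : ∀ {s} (d : Deriv s) → Variants (ht d) s
variants (ax r e)                 = variants-axiom r e
variants (un (⊤*L w≢ε) e d)       = variants-⊤*L w≢ε e (variants d)
variants (un ∧L e d)              = variants-∧L e (variants d)
variants (un ⇒R e d)              = variants-⇒R e (variants d)
variants (un (✶L x♯ y♯ x≢y) e d)  = variants-✶L x♯ y♯ x≢y e (variants d)
variants (un (−✶R x♯ z♯ x≢z) e d) = variants-−✶R x♯ z♯ x≢z e (variants d)
variants (un E e d)               = variants-E e (variants d)
variants (un U e d)               = variants-U e (variants d)
variants (un (A w♯) e d)          = variants-A w♯ e (variants d)
variants (un (AC w♯) e d)         = variants-AC w♯ e (variants d)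
variants (un (Eq₁ w≢ε) e d)       = variants-Eq₁ w≢ε e (variants d)
variants (un (Eq₂ w≢ε) e d)       = variants-Eq₂ w≢ε e (variants d)
variants (bin ∧R e d₁ d₂)         = variants-∧R e (variants d₁) (variants d₂)
variants (bin ⇒L e d₁ d₂)         = variants-⇒L e (variants d₁) (variants d₂)
variants (bin ✶R e d₁ d₂)         = variants-✶R e (variants d₁) (variants d₂)
variants (bin −✶L e d₁ d₂)        = variants-−✶L e (variants d₁) (variants d₂)

invert : ∀ {Γ Δ Γ' Δ' o Γ₀ Δ₀} (d : Deriv (Γ ⊢ Δ)) → Components (λ l → l) Γ' Δ' o → Removal o Γ Δ Γ₀ Δ₀ →
         Deriv≤ (ht d) (Γ' ++ Γ₀ ⊢ Δ' ++ Δ₀)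
invert {Γ' = Γ'} {Δ'} {Γ₀ = Γ₀} {Δ₀} d k r =
  subst (Deriv≤ (ht d)) (cong₂ _⊢_ (cong (Γ' ++_) (renameAnt-id Γ₀)) (cong (Δ' ++_) (renameSuc-id Δ₀)))
    (variants d (λ l → l) refl k r)

weaken : ∀ {Γ Δ} (d : Deriv (Γ ⊢ Δ)) X Y → Deriv≤ (ht d) (X ++ Γ ⊢ Y ++ Δ)
weaken d X Y = invert d none none

rename : ∀ {Γ Δ} (d : Deriv (Γ ⊢ Δ)) f → f ε ≡ ε → Deriv≤ (ht d) (renameSeq f (Γ ⊢ Δ))
rename d f fε = variants d f fε {[]} {[]} none none

premise₁-admissible : ∀ {p c} → Inst1 p c → (Π : Deriv c) → Deriv≤ (ht Π) p
premise₁-admissible (⊤*L {Γ} {Δ} {w} w≢ε) Π =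
  subst (Deriv≤ (ht Π)) (sym (substSeq-rename ε w Γ Δ))
    (variants Π (substL ε w) (substL-ε w≢ε) {[]} {[]} (⊤*L-inv (substL-hit ε w)) (left ↭-refl))
premise₁-admissible ∧L Π                       = invert Π (∧L-inv refl ↭-refl) (left ↭-refl)
premise₁-admissible ⇒R Π                       = invert Π (⇒R-inv refl ↭-refl ↭-refl) (right ↭-refl)
premise₁-admissible (✶L _ _ _) Π               = invert Π (✶L-inv refl ↭-refl) (left ↭-refl)
premise₁-admissible (−✶R _ _ _) Π              = invert Π (−✶R-inv refl ↭-refl ↭-refl) (right ↭-refl)
premise₁-admissible (E {x = x} {y} {z}) Π      = weaken Π (rel y x z ∷ []) []
premise₁-admissible (U {x = x}) Π              = weaken Π (rel x ε x ∷ []) []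
premise₁-admissible (A {y = y} {z} {u} {v} {w} _) Π = weaken Π (rel u w z ∷ rel y v w ∷ []) []
premise₁-admissible (AC {x = x} {y} {w} _) Π   = weaken Π (rel x w x ∷ rel y y w ∷ []) []
premise₁-admissible (Eq₁ {Γ} {Δ} {w} {w'} w≢ε) Π =
  subst (Deriv≤ (ht Π)) (cong₂ (λ a S → prepend (a ∷ []) [] S)
                               (rel-cong (substL-ε w≢ε) (substL-hit w' w) (substL-target w' w))
                               (sym (substSeq-rename w' w Γ Δ)))
    (rename Π (substL w' w) (substL-ε w≢ε))
premise₁-admissible (Eq₂ {Γ} {Δ} {w} {w'} w≢ε) Π =
  subst (Deriv≤ (ht Π)) (cong₂ (λ a S → prepend (a ∷ []) [] S)
                               (rel-cong (substL-ε w≢ε) (substL-target w' w) (substL-hit w' w))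
                               (sym (substSeq-rename w' w Γ Δ)))
    (rename Π (substL w' w) (substL-ε w≢ε))

premises₂-admissible : ∀ {p q c} → Inst2 p q c → (Π : Deriv c) → Deriv≤ (ht Π) p × Deriv≤ (ht Π) q
premises₂-admissible ∧R Π = invert Π (∧R-inv₁ refl ↭-refl) (right ↭-refl) , invert Π (∧R-inv₂ refl ↭-refl) (right ↭-refl)
premises₂-admissible ⇒L Π = invert Π (⇒L-inv₁ refl ↭-refl) (left ↭-refl) , invert Π (⇒L-inv₂ refl ↭-refl) (left ↭-refl)
premises₂-admissible (✶R {x = x} {y} {A = F₁} {F₂}) Π = weaken Π [] ((x ∶ F₁) ∷ []) , weaken Π [] ((y ∶ F₂) ∷ [])
premises₂-admissible (−✶L {x = x} {z = z} {A = F₁} {F₂}) Π =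
  weaken Π [] ((x ∶ F₁) ∷ []) ,
  Deriv≤-resp-≈S (↭-trans (swap _ _ ↭-refl) (prep _ (swap _ _ ↭-refl)) , ↭-refl) (weaken Π (lf (z ∶ F₂) ∷ []) [])

lemma3 : (∀ {p c} → Inst1 p c → (Π : Deriv c) →
            Σ (Deriv p) (λ Π' → ht Π' ≤ ht Π))
       × (∀ {p q c} → Inst2 p q c → (Π : Deriv c) →
            Σ (Deriv p) (λ Π₁ → ht Π₁ ≤ ht Π) × Σ (Deriv q) (λ Π₂ → ht Π₂ ≤ ht Π))
lemma3 = premise₁-admissible , premises₂-admissible
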